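{- If $G$ is a finite simple graph of order $n$ with minimum degree at least $3$ that has a universal vertex (a vertex adjacent to every other vertex), then $C_{tr}(G)=n$.
   Context: A set $S\subseteq V$ is a total restrained dominating set (TRD-set) of $G=(V,E)$ if every vertex of $V\setminus S$ is adjacent to at least one vertex of $S$ and to at least one other vertex of $V\setminus S$, and every vertex of $S$ is adjacent to at least one other vertex of $S$. Two disjoint sets $X,Y\subseteq V$ form a total restrained coalition if neither is a TRD-set but $X\cup Y$ is a TRD-set. A trc-partition of $G$ is a partition $\Phi$ of $V$ such that no member of $\Phi$ is a TRD-set and each member forms a total restrained coalition with some other member of $\Phi$. $C_{tr}(G)$ is the maximum cardinality of a trc-partition of $G$. -}

module Defs where

open import Data.Nat using (ℕ; _≤_)
open import Data.Fin using (Fin)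
open import Data.Fin.Subset using (∣_∣)
open import Data.Bool using (Bool; true; false)
open import Data.Vec using (tabulate)
open import Data.Product using (Σ; ∃; _×_)
open import Data.Sum using (_⊎_)
open import Relation.Nullary using (¬_)
open import Relation.Binary.PropositionalEquality using (_≡_; _≢_)

record Graph (n : ℕ) : Set where
  field
    adj     : Fin n → Fin n → Bool
    symm    : ∀ u v → adj u v ≡ adj v u
    irrefl  : ∀ v → adj v v ≡ false

module _ {n : ℕ} (G : Graph n) where
  open Graph G

  Adj : Fin n → Fin n → Set
  Adj u v = adj u v ≡ true

  degree : Fin n → ℕ
  degree v = ∣ tabulate (adj v) ∣

  MinDegreeAtLeast : ℕ → Set
  MinDegreeAtLeast d = ∀ v → d ≤ degree v

  HasUniversalVertex : Set
  HasUniversalVertex = ∃ λ u → ∀ v → v ≢ u → Adj u v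

  IsTRD : (Fin n → Set) → Set
  IsTRD S =
    (∀ v → ¬ S v →
        (∃ λ u → S u × Adj v u)
      × (∃ λ u → ¬ S u × u ≢ v × Adj v u))
    × (∀ v → S v → ∃ λ u → S u × u ≢ v × Adj v u)

  Part : ∀ {k} → (Fin n → Fin k) → Fin k → Fin n → Set
  Part p i v = p v ≡ i

  _∪_ : (Fin n → Set) → (Fin n → Set) → Fin n → Set
  (X ∪ Y) v = X v ⊎ Y v

  TotalRestrainedCoalition : (Fin n → Set) → (Fin n → Set) → Set
  TotalRestrainedCoalition X Y = ¬ IsTRD X × ¬ IsTRD Y × IsTRD (X ∪ Y)

  -- a trc-partition into k (nonempty) parts, encoded by the map p
  -- sending each vertex to the index of its part
  IsTRCPartition : (k : ℕ) → (Fin n → Fin k) → Set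
  IsTRCPartition k p =
      (∀ i → ∃ λ v → p v ≡ i)
    × (∀ i → ¬ IsTRD (Part p i))
    × (∀ i → ∃ λ j → j ≢ i × TotalRestrainedCoalition (Part p i) (Part p j))

  CtrEquals : ℕ → Set
  CtrEquals m =
      (Σ (Fin n → Fin m) λ p → IsTRCPartition m p)
    × (∀ k (p : Fin n → Fin k) → IsTRCPartition k p → k ≤ m)

-- No singleton is a TRD-set, since a vertex of a TRD-set needs a neighbour inside it,
-- so the partition into singletons has no TRD part. For a universal vertex u and any
-- neighbour v, the pair {u, v} is a TRD-set: u dominates everything, and minimum
-- degree 3 leaves every other vertex a neighbour outside {u, v}. Hence {i} forms a
-- coalition with {u} for i ≠ u, and {u} with {v}. No trc-partition has more than n
-- parts because its parts are nonempty.
module Submission where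

open import Defs
open import Data.Nat using (ℕ; suc; _≤_; _<_; s≤s)
open import Data.Nat.Properties using (≤-refl; ≤-trans; n≤1+n; <-irrefl)
open import Data.Fin using (Fin; zero; suc)
open import Data.Fin.Properties using (_≟_; injective⇒≤)
open import Data.Fin.Subset using (Subset; inside; outside; _∈_; _∉_; _-_; Nonempty; ∣_∣)
open import Data.Fin.Subset.Properties using (nonempty?; Empty-unique; ∣⊥∣≡0; p─q⊆p)
open import Data.Vec using (_∷_; tabulate; there)
open import Data.Vec.Properties using ([]=⇒lookup; lookup∘tabulate; zipWith-replicate₂; map-id)
open import Data.Product using (∃; _×_; _,_; proj₁; proj₂)
open import Data.Sum using (_⊎_; inj₁; inj₂; [_,_]; swap)
open import Function using (id; _∘_)
open import Function.Definitions using (StrictlySurjective)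
open import Relation.Nullary using (¬_; yes; no; contradiction)
open import Relation.Binary.PropositionalEquality using (_≡_; _≢_; refl; sym; trans; cong; subst)

x∉p-x : ∀ {n} (p : Subset n) x → x ∉ p - x
x∉p-x (s ∷ p) zero    ()
x∉p-x (s ∷ p) (suc x) (there x∈p-x) = x∉p-x p x x∈p-x

x∈p-y⇒x≢y : ∀ {n} {p : Subset n} {x y} → x ∈ p - y → x ≢ y
x∈p-y⇒x≢y {p = p} {x} x∈p-x refl = x∉p-x p x x∈p-x

s∷p-zero≡outside∷p : ∀ {n} s (p : Subset n) → (s ∷ p) - zero ≡ outside ∷ p
s∷p-zero≡outside∷p s p = cong (outside ∷_) (trans (zipWith-replicate₂ _ p outside) (map-id p))

∣p∣≤1+∣p-x∣ : ∀ {n} (p : Subset n) x → ∣ p ∣ ≤ suc ∣ p - x ∣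
∣p∣≤1+∣p-x∣ (s ∷ p) zero =
  subst (λ q → ∣ s ∷ p ∣ ≤ suc ∣ q ∣) (sym (s∷p-zero≡outside∷p s p)) (∣s∷p∣≤1+∣p∣ s)
  where
  ∣s∷p∣≤1+∣p∣ : ∀ s → ∣ s ∷ p ∣ ≤ suc ∣ p ∣
  ∣s∷p∣≤1+∣p∣ inside  = ≤-refl
  ∣s∷p∣≤1+∣p∣ outside = n≤1+n _
∣p∣≤1+∣p-x∣ (inside  ∷ p) (suc x) = s≤s (∣p∣≤1+∣p-x∣ p x)
∣p∣≤1+∣p-x∣ (outside ∷ p) (suc x) = ∣p∣≤1+∣p-x∣ p x

0<∣p∣⇒Nonempty : ∀ {n} {p : Subset n} → 0 < ∣ p ∣ → Nonempty p
0<∣p∣⇒Nonempty {n} {p} 0<∣p∣ with nonempty? p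
... | yes p≠∅ = p≠∅
... | no  p≡∅ = contradiction 0<∣⊥∣ (<-irrefl refl)
  where
  0<∣⊥∣ : 0 < 0
  0<∣⊥∣ = subst (0 <_) (∣⊥∣≡0 n) (subst (λ q → 0 < ∣ q ∣) (Empty-unique p≡∅) 0<∣p∣)

∈-avoiding₂ : ∀ {n} (p : Subset n) a b → 3 ≤ ∣ p ∣ → ∃ λ x → x ∈ p × x ≢ a × x ≢ b
∈-avoiding₂ p a b 3≤∣p∣ =
  let x , x∈p-a-b = 0<∣p∣⇒Nonempty 0<∣p-a-b∣
      x∈p-a       = p─q⊆p _ _ x∈p-a-b
  in x , p─q⊆p _ _ x∈p-a , x∈p-y⇒x≢y x∈p-a , x∈p-y⇒x≢y x∈p-a-b
  where
  0<∣p-a-b∣ : 0 < ∣ p - a - b ∣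
  0<∣p-a-b∣ with ≤-trans 3≤∣p∣ (≤-trans (∣p∣≤1+∣p-x∣ p a) (s≤s (∣p∣≤1+∣p-x∣ (p - a) b)))
  ... | s≤s (s≤s 1≤∣p-a-b∣) = 1≤∣p-a-b∣

surjective⇒≥ : ∀ {m n} {f : Fin m → Fin n} → StrictlySurjective _≡_ f → n ≤ m
surjective⇒≥ {m} {n} {f} surj = injective⇒≤ section-injective
  where
  section : Fin n → Fin m
  section i = proj₁ (surj i)
  section-injective : ∀ {i j} → section i ≡ section j → i ≡ j
  section-injective {i} {j} eq = trans (sym (proj₂ (surj i))) (trans (cong f eq) (proj₂ (surj j)))

module _ {n : ℕ} (G : Graph n) where
  open Graph G

  Adj-sym : ∀ {u v} → Adj G u v → Adj G v u
  Adj-sym {u} {v} uv = trans (symm v u) uv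

  Adj⇒≢ : ∀ {u v} → Adj G u v → u ≢ v
  Adj⇒≢ {u} uu refl with trans (sym (irrefl u)) uu
  ... | ()

  ∈-neighbours⇒Adj : ∀ {w x} → x ∈ tabulate (adj w) → Adj G w x
  ∈-neighbours⇒Adj {w} {x} x∈N = trans (sym (lookup∘tabulate (adj w) x)) ([]=⇒lookup x∈N)

  neighbour-avoiding₂ : MinDegreeAtLeast G 3 → ∀ w a b → ∃ λ x → x ≢ a × x ≢ b × Adj G w x
  neighbour-avoiding₂ δ≥3 w a b =
    let x , x∈N , x≢a , x≢b = ∈-avoiding₂ (tabulate (adj w)) a b (δ≥3 w)
    in x , x≢a , x≢b , ∈-neighbours⇒Adj x∈N

  singleton-¬IsTRD : ∀ i → ¬ IsTRD G (λ v → v ≡ i)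
  singleton-¬IsTRD i (_ , total) with total i refl
  ... | _ , refl , i≢i , _ = i≢i refl

  module _ (δ≥3 : MinDegreeAtLeast G 3) {u : Fin n} (universal : ∀ v → v ≢ u → Adj G u v) where

    universal-edge-IsTRD : ∀ {v} (S : Fin n → Set) → Adj G u v → S u → S v →
                           (∀ w → S w → w ≡ u ⊎ w ≡ v) → IsTRD G S
    universal-edge-IsTRD {v} S uv Su Sv S⊆uv = restrained-dominating , total
      where
      restrained-dominating : ∀ w → ¬ S w →
        (∃ λ x → S x × Adj G w x) × (∃ λ x → ¬ S x × x ≢ w × Adj G w x)
      restrained-dominating w w∉S =
        let x , x≢u , x≢v , wx = neighbour-avoiding₂ δ≥3 w u v
        in (u , Su , Adj-sym (universal w λ { refl → w∉S Su }))
         , (x , [ x≢u , x≢v ] ∘ S⊆uv x , Adj⇒≢ wx ∘ sym , wx)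
      total : ∀ w → S w → ∃ λ x → S x × x ≢ w × Adj G w x
      total w Sw with S⊆uv w Sw
      ... | inj₁ refl = v , Sv , Adj⇒≢ uv ∘ sym , uv
      ... | inj₂ refl = u , Su , Adj⇒≢ uv , Adj-sym uv

    singleton-coalition-partner : ∀ i → ∃ λ j → j ≢ i ×
      TotalRestrainedCoalition G (λ v → v ≡ i) (λ v → v ≡ j)
    singleton-coalition-partner i with i ≟ u
    ... | no i≢u =
      u , i≢u ∘ sym , singleton-¬IsTRD i , singleton-¬IsTRD u ,
      universal-edge-IsTRD _ (universal i i≢u) (inj₂ refl) (inj₁ refl) (λ _ → swap)
    ... | yes refl =
      let v , v≢u , _ , uv = neighbour-avoiding₂ δ≥3 u u u
      in v , v≢u , singleton-¬IsTRD u , singleton-¬IsTRD v ,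
         universal-edge-IsTRD _ uv (inj₁ refl) (inj₂ refl) (λ _ → id)

    discrete-IsTRCPartition : IsTRCPartition G n id
    discrete-IsTRCPartition = (λ i → i , refl) , singleton-¬IsTRD , singleton-coalition-partner

proposition4p1 : (n : ℕ) (G : Graph n) →
    MinDegreeAtLeast G 3 → HasUniversalVertex G → CtrEquals G n
proposition4p1 n G δ≥3 (u , universal) =
  (id , discrete-IsTRCPartition G δ≥3 universal) , λ _ _ (surjective , _) → surjective⇒≥ surjective
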